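{- Let $G$ be a graph on a vertex set $V$ with $n$ vertices, let $k\ge 3$, and assume that $G$ contains no cycles of length less than or equal to $k$, but does contain a cycle of length $k+1$. Then the face lattice of $\Delta_k(G)$ coincides with the poset $P(n,k)\setminus \bigl(\mathcal{Z}_k(G) \cup \mathcal{Y}_{k+1}(G)\bigr)$. In particular, $\Delta_k(G)$ contains a complete $(n-k-3)$-skeleton (every subset of $V$ of size at most $n-k-2$ is a face). The reduced Euler characteristic of $\Delta_k(G)$ is then \[ (-1)^{n-k-1}\left(\binom{n-1}{k-1} + |\mathcal{Y}_{k+1}(G)| -|\mathcal{Z}_k(G)|\right) =(-1)^{n-k-1}\left(|\{F:F \text{ is a facet of }\Delta_k(G)\}| - \binom{n-1}{k} +|\mathcal{Y}_{k+1}(G)| \right). \]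
   Context: For a graph $G=(V,E)$ with $|V|=n$ and $k\ge 2$, the $k$-cut complex $\Delta_k(G)$ is the simplicial complex on $V$ whose facets are the subsets $F\subseteq V$ with $|F|=n-k$ such that the induced subgraph $G[V\setminus F]$ is disconnected. The face lattice of a complex is the set of its faces (including the empty face) ordered by inclusion with an artificially appended top element $\hat1$. $P(n,k)$ is the truncated Boolean lattice of all subsets of $V$ of size at most $n-k$, ordered by inclusion, with an appended top element $\hat1$. $\mathcal{Z}_k(G)=\{V\setminus A: |A|=k,\ G[A]\text{ connected}\}$ and $\mathcal{Y}_{k+1}(G)=\{V\setminus B: B\text{ is the vertex set of a cycle of length }k+1\text{ in }G\}$. The reduced Euler characteristic is $\tilde\chi(\Delta)=\sum_{i\ge-1}(-1)^if_i$, $f_i$ the number of $i$-dimensional faces. -}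

module Defs where

open import Data.Nat using (ℕ; zero; suc; _+_; _≤_; _<_; _∸_)
open import Data.Nat.Properties using (_≟_)
open import Data.Integer as ℤ using (ℤ; +_; -_)
open import Data.Bool using (Bool; true; false)
open import Data.Fin using (Fin; zero; suc; inject₁; fromℕ)
open import Data.Fin.Subset using (Subset; _∈_; _⊆_; ∁; ∣_∣)
open import Data.Vec using (Vec; []; _∷_)
open import Data.List using (List; []; _∷_; _++_; map; filter; length)
open import Data.Product using (Σ; ∃; _×_; _,_)
open import Data.Empty using (⊥)
open import Function.Bundles using (_⇔_)
open import Function.Definitions using (Injective)
open import Relation.Nullary using (¬_; Dec)
open import Relation.Nullary.Decidable using (_×-dec_)
open import Relation.Unary using (Decidable)
open import Relation.Binary.PropositionalEquality using (_≡_)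

record SimpleGraph (n : ℕ) : Set₁ where
  field
    Adj     : Fin n → Fin n → Set
    symm    : ∀ {u v} → Adj u v → Adj v u
    irrefl  : ∀ {u} → ¬ Adj u u
open SimpleGraph public

module _ {n : ℕ} (G : SimpleGraph n) where

  data ReachIn (A : Subset n) : Fin n → Fin n → Set where
    here : ∀ {u} → u ∈ A → ReachIn A u u
    step : ∀ {u w v} → u ∈ A → Adj G u w → ReachIn A w v → ReachIn A u v

  Connected : Subset n → Set
  Connected A = ∀ u v → u ∈ A → v ∈ A → ReachIn A u v

  Disconnected : Subset n → Set
  Disconnected A = ¬ Connected A

  -- A cycle of length (suc m) (with suc m ≥ 3): distinct vertices c 0, …, c m,
  -- consecutive ones adjacent, and c m adjacent to c 0.
  record CycleOf (m : ℕ) : Set where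
    field
      len≥3   : 3 ≤ suc m
      vert    : Fin (suc m) → Fin n
      inj     : Injective _≡_ _≡_ vert
      consec  : ∀ (i : Fin m) → Adj G (vert (inject₁ i)) (vert (suc i))
      closing : Adj G (vert (fromℕ m)) (vert zero)
  open CycleOf public

  HasCycleOfLength : ℕ → Set
  HasCycleOfLength zero    = ⊥
  HasCycleOfLength (suc m) = CycleOf m

  IsFacet : ℕ → Subset n → Set
  IsFacet k F = (∣ F ∣ ≡ n ∸ k) × Disconnected (∁ F)

  IsFace : ℕ → Subset n → Set
  IsFace k σ = ∃ λ F → IsFacet k F × σ ⊆ F

  InZ : ℕ → Subset n → Set
  InZ k σ = ∃ λ A → (∣ A ∣ ≡ k) × Connected A × (σ ≡ ∁ A)

  InY : ℕ → Subset n → Set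
  InY k σ = Σ (CycleOf k) λ c → ∀ x → (x ∈ ∁ σ) ⇔ (∃ λ i → vert c i ≡ x)

allSubsets : (n : ℕ) → List (Subset n)
allSubsets zero    = [] ∷ []
allSubsets (suc n) = map (true ∷_) (allSubsets n) ++ map (false ∷_) (allSubsets n)

count : ∀ {n} {P : Subset n → Set} → Decidable P → ℕ
count {n} d = length (filter d (allSubsets n))

sgn : ℕ → ℤ
sgn zero    = + 1
sgn (suc j) = - sgn j

-- f-vector: number of faces with exactly j elements, i.e. f_{j-1}
faceCountOfSize : ∀ {n} {P : Subset n → Set} → Decidable P → ℕ → ℕ
faceCountOfSize d j = count (λ σ → d σ ×-dec (∣ σ ∣ ≟ j))

-- reduced Euler characteristic  Σ_{i ≥ -1} (-1)^i f_i  =  Σ_{j=0}^{n} (-1)^(j+1) f_{j-1}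
sumTo : ℕ → (ℕ → ℤ) → ℤ
sumTo zero    f = f zero
sumTo (suc m) f = sumTo m f ℤ.+ f (suc m)

reducedEuler : ∀ {n} {P : Subset n → Set} → Decidable P → ℤ
reducedEuler {n} d = sumTo n (λ j → sgn (suc j) ℤ.* + faceCountOfSize d j)

{-# OPTIONS --safe #-}
module Submission where

-- Let |σ| ≤ n − k and S = V ∖ σ. A facet containing σ is the complement of a k-subset of S
-- inducing a disconnected graph, so σ is a non-face exactly when every k-subset of S induces
-- a connected graph. In that case:
--   * if |S| = k, then σ ∈ 𝒵_k;
--   * every u in a (k+1)-subset B of S has two neighbours in B: removing some v ≠ u from B
--     leaves a connected set, so u has a neighbour c there, and then B − c gives a second one;
--   * if |S| = k + 1, a path between two neighbours of u inside the connected set S − u closes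
--     a cycle through u; having more than k vertices, it runs through all of S, so σ ∈ 𝒴_{k+1};
--   * if |S| ≥ k + 2, using S and then S − c₁ gives u three neighbours c₁, c₂, c₃. In a
--     connected k-subset K of S − u containing them, a path from c₁ to c₂ either avoids c₃ or
--     contains a shorter path from c₃ to c₂; in both cases u closes a cycle of length ≤ k.
-- Conversely, if F ⊇ σ is a facet then V ∖ F is a k-subset of S. For σ ∈ 𝒵_k it equals S, and
-- for σ ∈ 𝒴_{k+1} it is a (k+1)-cycle minus one vertex; both are connected.
-- Hence the faces are all sets of size below n − k − 1, those of size n − k − 1 outside 𝒴_{k+1}
-- and those of size n − k outside 𝒵_k. The Euler characteristic then follows from
-- Σ_{j ≤ m} (−1)^{j+1} C(n, j) = (−1)^{m+1} C(n − 1, m), and the facet count from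
-- |facets| + |𝒵_k| = C(n, k) = C(n − 1, k − 1) + C(n − 1, k).

open import Defs
open import Data.Nat using (ℕ; zero; suc; _+_; _≤_; _<_; _∸_; z≤n; s≤s)
open import Data.Nat.Properties
open import Data.Nat.Combinatorics using (_C_; nCk≡nC[n∸k]; nCk+nC[k+1]≡[n+1]C[k+1])
open import Data.Integer as ℤ using (ℤ; +_; -_; _-_; 0ℤ)
import Data.Integer.Properties as ℤₚ
open import Data.Integer.Solver using (module +-*-Solver)
open import Data.Bool using (true; false)
open import Data.Bool.Properties using (not-involutive)
open import Data.Fin using (Fin; zero; suc; inject₁; fromℕ) renaming (_≤_ to _≤ᶠ_; _<_ to _<ᶠ_)
import Data.Fin.Properties as Fin
open import Data.Fin.Subset
  using (Subset; _∈_; _∉_; _⊆_; ∁; ∣_∣; ⁅_⁆; _∪_; _─_; Nonempty; inside; outside)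
open import Data.Fin.Subset.Properties
open import Data.Vec using ([]; _∷_; here; there)
open import Data.List using (List; []; _∷_; _++_; map; filter; length; lookup)
open import Data.List.Properties using (filter-++; length-++; filter-≐; filter-none)
open import Data.List.Membership.Propositional using () renaming (_∈_ to _∈ᴸ_; _∉_ to _∉ᴸ_)
open import Data.List.Membership.Propositional.Properties using (∈-lookup)
open import Data.List.Relation.Unary.Any using (here; there)
open import Data.List.Relation.Unary.All as All using ([]; universal)
open import Data.List.Relation.Unary.All.Properties using (¬Any⇒All¬)
open import Data.List.Relation.Unary.AllPairs using ([]; _∷_)
open import Data.List.Relation.Unary.Unique.Propositional using (Unique)
open import Data.Product using (Σ; ∃; ∃₂; _×_; _,_; proj₁; proj₂) renaming (map to mapΣ)
open import Data.Sum using (_⊎_; inj₁; inj₂; [_,_]′)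
open import Data.Empty using (⊥; ⊥-elim)
open import Effect.Monad using (RawMonad)
open import Function using (_∘_; id)
open import Function.Bundles using (_⇔_; mk⇔; Equivalence)
open import Function.Definitions using (Injective)
open import Level using (0ℓ)
open import Relation.Nullary using (¬_; ¬?; yes; no; does; contradiction)
open import Relation.Nullary.Decidable using (_×-dec_)
open import Relation.Nullary.Negation using (¬¬-Monad)
open import Relation.Unary using (Decidable)
open import Relation.Binary.Definitions using (tri<; tri≈; tri>)
open import Relation.Binary.PropositionalEquality
  using (_≡_; _≢_; refl; sym; trans; cong; cong₂; subst; subst₂; ≢-sym; module ≡-Reasoning)

open +-*-Solver using (solve; _:=_; _:+_; _:*_; :-_; _:-_)
open RawMonad (¬¬-Monad {a = 0ℓ}) using (_>>=_; pure)

private variable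
  n m : ℕ
  p q : Subset n
  x y : Fin n
  P Q R : Subset n → Set

-- Subsets of Fin n

∁-involutive : (p : Subset n) → ∁ (∁ p) ≡ p
∁-involutive []      = refl
∁-involutive (s ∷ p) = cong₂ _∷_ (not-involutive s) (∁-involutive p)

∣p∣≡n∸∣∁p∣ : (p : Subset n) → ∣ p ∣ ≡ n ∸ ∣ ∁ p ∣
∣p∣≡n∸∣∁p∣ p = trans (cong ∣_∣ (sym (∁-involutive p))) (∣∁p∣≡n∸∣p∣ (∁ p))

∣p∣≡1+∣p-x∣ : x ∈ p → ∣ p ∣ ≡ suc ∣ p ─ ⁅ x ⁆ ∣
∣p∣≡1+∣p-x∣ {p = inside  ∷ p} here        = cong (suc ∘ ∣_∣) (sym (p─⊥≡p p))
∣p∣≡1+∣p-x∣ {p = inside  ∷ p} (there x∈p) = cong suc (∣p∣≡1+∣p-x∣ x∈p)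
∣p∣≡1+∣p-x∣ {p = outside ∷ p} (there x∈p) = ∣p∣≡1+∣p-x∣ x∈p

∣p∣≤1+∣p-x∣ : ∀ (p : Subset n) x → ∣ p ∣ ≤ suc ∣ p ─ ⁅ x ⁆ ∣
∣p∣≤1+∣p-x∣ p x with x ∈? p
... | yes x∈p = ≤-reflexive (∣p∣≡1+∣p-x∣ x∈p)
... | no  x∉p = m≤n⇒m≤1+n (p⊆q⇒∣p∣≤∣q∣ {p = p} {q = p ─ ⁅ x ⁆}
                  (λ y∈p → x∈p∧x≢y⇒x∈p-y y∈p λ { refl → x∉p y∈p }))

∣p-x∣≡m : x ∈ p → ∣ p ∣ ≡ suc m → ∣ p ─ ⁅ x ⁆ ∣ ≡ m
∣p-x∣≡m x∈p ∣p∣≡1+m = suc-injective (trans (sym (∣p∣≡1+∣p-x∣ x∈p)) ∣p∣≡1+m)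

x∈p-y⇒x≢y : x ∈ p ─ ⁅ y ⁆ → x ≢ y
x∈p-y⇒x≢y {x = zero}  {p = _ ∷ _} ()            refl
x∈p-y⇒x≢y {x = suc _} {p = _ ∷ _} (there x∈p-y) refl = x∈p-y⇒x≢y x∈p-y refl

p-x⊆p : p ─ ⁅ x ⁆ ⊆ p
p-x⊆p {p = p} {x = x} = p─q⊆p p ⁅ x ⁆

x∈p⇒⁅x⁆⊆p : x ∈ p → ⁅ x ⁆ ⊆ p
x∈p⇒⁅x⁆⊆p {p = p} x∈p y∈⁅x⁆ = subst (_∈ p) (sym (x∈⁅y⁆⇒x≡y _ y∈⁅x⁆)) x∈p

p⊆r∧q⊆r⇒p∪q⊆r : {r : Subset n} → p ⊆ r → q ⊆ r → p ∪ q ⊆ r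
p⊆r∧q⊆r⇒p∪q⊆r {p = p} {q = q} p⊆r q⊆r x∈p∪q with x∈p∪q⁻ p q x∈p∪q
... | inj₁ x∈p = p⊆r x∈p
... | inj₂ x∈q = q⊆r x∈q

⁅x⁆∪⁅y⁆∪⁅z⁆⊆p : {z : Fin n} → x ∈ p → y ∈ p → z ∈ p → ⁅ x ⁆ ∪ ⁅ y ⁆ ∪ ⁅ z ⁆ ⊆ p
⁅x⁆∪⁅y⁆∪⁅z⁆⊆p x∈p y∈p z∈p =
  p⊆r∧q⊆r⇒p∪q⊆r (x∈p⇒⁅x⁆⊆p x∈p) (p⊆r∧q⊆r⇒p∪q⊆r (x∈p⇒⁅x⁆⊆p y∈p) (x∈p⇒⁅x⁆⊆p z∈p))

∣p∪q∣≤∣p∣+∣q∣ : (p q : Subset n) → ∣ p ∪ q ∣ ≤ ∣ p ∣ + ∣ q ∣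
∣p∪q∣≤∣p∣+∣q∣ []            []            = z≤n
∣p∪q∣≤∣p∣+∣q∣ (inside  ∷ p) (s ∷ q)       =
  s≤s (≤-trans (∣p∪q∣≤∣p∣+∣q∣ p q) (+-monoʳ-≤ ∣ p ∣ (∣p∣≤∣x∷p∣ s q)))
∣p∪q∣≤∣p∣+∣q∣ (outside ∷ p) (inside  ∷ q) =
  ≤-trans (s≤s (∣p∪q∣≤∣p∣+∣q∣ p q)) (≤-reflexive (sym (+-suc ∣ p ∣ ∣ q ∣)))
∣p∪q∣≤∣p∣+∣q∣ (outside ∷ p) (outside ∷ q) = ∣p∪q∣≤∣p∣+∣q∣ p q

∣⁅x⁆∪⁅y⁆∪⁅z⁆∣≤3 : (x y z : Fin n) → ∣ ⁅ x ⁆ ∪ ⁅ y ⁆ ∪ ⁅ z ⁆ ∣ ≤ 3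
∣⁅x⁆∪⁅y⁆∪⁅z⁆∣≤3 x y z = begin
  ∣ ⁅ x ⁆ ∪ ⁅ y ⁆ ∪ ⁅ z ⁆ ∣           ≤⟨ ∣p∪q∣≤∣p∣+∣q∣ ⁅ x ⁆ _ ⟩
  ∣ ⁅ x ⁆ ∣ + ∣ ⁅ y ⁆ ∪ ⁅ z ⁆ ∣       ≤⟨ +-monoʳ-≤ ∣ ⁅ x ⁆ ∣ (∣p∪q∣≤∣p∣+∣q∣ ⁅ y ⁆ ⁅ z ⁆) ⟩
  ∣ ⁅ x ⁆ ∣ + (∣ ⁅ y ⁆ ∣ + ∣ ⁅ z ⁆ ∣) ≡⟨ cong₂ _+_ (∣⁅x⁆∣≡1 x) (cong₂ _+_ (∣⁅x⁆∣≡1 y) (∣⁅x⁆∣≡1 z)) ⟩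
  3                                   ∎
  where open ≤-Reasoning

∣p∣>0⇒nonempty : {p : Subset n} → 0 < ∣ p ∣ → Nonempty p
∣p∣>0⇒nonempty {n = n} {p = p} 0<∣p∣ with nonempty? p
... | yes ne = ne
... | no ¬ne = contradiction (trans (cong ∣_∣ (Empty-unique ¬ne)) (∣⊥∣≡0 n)) (n>0⇒n≢0 0<∣p∣)

∣p∣<∣q∣⇒∃∈q∖p : (p q : Subset n) → ∣ p ∣ < ∣ q ∣ → ∃ λ x → x ∈ q × x ∉ p
∣p∣<∣q∣⇒∃∈q∖p p q ∣p∣<∣q∣ with Fin.any? (λ x → x ∈? q ×-dec ¬? (x ∈? p))
... | yes witness = witness
... | no ¬witness = contradiction (p⊆q⇒∣p∣≤∣q∣ q⊆p) (<⇒≱ ∣p∣<∣q∣)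
  where
  q⊆p : q ⊆ p
  q⊆p {x} x∈q with x ∈? p
  ... | yes x∈p = x∈p
  ... | no  x∉p = contradiction (x , x∈q , x∉p) ¬witness

p⊆q∧∣q∣≤∣p∣⇒q⊆p : p ⊆ q → ∣ q ∣ ≤ ∣ p ∣ → q ⊆ p
p⊆q∧∣q∣≤∣p∣⇒q⊆p {p = p} p⊆q ∣q∣≤∣p∣ {x} x∈q with x ∈? p
... | yes x∈p = x∈p
... | no  x∉p = contradiction (p⊂q⇒∣p∣<∣q∣ (p⊆q , x , x∈q , x∉p)) (≤⇒≯ ∣q∣≤∣p∣)

subset-of-size : p ⊆ q → ∣ p ∣ ≤ m → m ≤ ∣ q ∣ → ∃ λ r → p ⊆ r × r ⊆ q × ∣ r ∣ ≡ m
subset-of-size {p = p} {q = q} {m = m} p⊆q ∣p∣≤m m≤∣q∣ =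
  shrink (∣ q ∣ ∸ m) p⊆q (sym (m+[n∸m]≡n m≤∣q∣))
  where
  shrink : ∀ d {q : Subset _} → p ⊆ q → ∣ q ∣ ≡ m + d → ∃ λ r → p ⊆ r × r ⊆ q × ∣ r ∣ ≡ m
  shrink zero    {q} p⊆q ∣q∣≡m+0   = q , p⊆q , id , trans ∣q∣≡m+0 (+-identityʳ m)
  shrink (suc d) {q} p⊆q ∣q∣≡m+1+d =
    let ∣q∣≡1+m+d     = trans ∣q∣≡m+1+d (+-suc m d)
        x , x∈q , x∉p = ∣p∣<∣q∣⇒∃∈q∖p p q
                          (≤-trans (s≤s (≤-trans ∣p∣≤m (m≤m+n m d))) (≤-reflexive (sym ∣q∣≡1+m+d)))
        p⊆q-x : p ⊆ q ─ ⁅ x ⁆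
        p⊆q-x y∈p = x∈p∧x≢y⇒x∈p-y (p⊆q y∈p) λ { refl → x∉p y∈p }
        r , p⊆r , r⊆q-x , ∣r∣≡m = shrink d p⊆q-x (∣p-x∣≡m x∈q ∣q∣≡1+m+d)
    in r , p⊆r , p-x⊆p ∘ r⊆q-x , ∣r∣≡m

f[1+i]∈p-f[0] : (f : Fin (suc m) → Fin n) → Injective _≡_ _≡_ f → (∀ i → f i ∈ p) →
                ∀ i → f (suc i) ∈ p ─ ⁅ f zero ⁆
f[1+i]∈p-f[0] f f-inj f∈p i = x∈p∧x≢y⇒x∈p-y (f∈p (suc i)) (Fin.0≢1+n ∘ sym ∘ f-inj)

injection⇒m≤∣p∣ : (f : Fin m → Fin n) → Injective _≡_ _≡_ f → (∀ i → f i ∈ p) → m ≤ ∣ p ∣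
injection⇒m≤∣p∣ {m = zero}  f _     _   = z≤n
injection⇒m≤∣p∣ {m = suc m} f f-inj f∈p = subst (suc m ≤_) (sym (∣p∣≡1+∣p-x∣ (f∈p zero)))
  (s≤s (injection⇒m≤∣p∣ (f ∘ suc) (Fin.suc-injective ∘ f-inj) (f[1+i]∈p-f[0] f f-inj f∈p)))

injection∧∣p∣≤m⇒onto : (f : Fin m → Fin n) → Injective _≡_ _≡_ f → (∀ i → f i ∈ p) → ∣ p ∣ ≤ m →
                       x ∈ p → ∃ λ i → f i ≡ x
injection∧∣p∣≤m⇒onto {m = zero} f _ _ ∣p∣≤0 x∈p =
  contradiction (≤-trans (≤-<-trans z≤n (x∈p⇒∣p-x∣<∣p∣ x∈p)) ∣p∣≤0) λ ()
injection∧∣p∣≤m⇒onto {m = suc m} {x = x} f f-inj f∈p ∣p∣≤1+m x∈p with x Fin.≟ f zero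
... | yes refl = zero , refl
... | no  x≢f0 = mapΣ suc id
  (injection∧∣p∣≤m⇒onto (f ∘ suc) (Fin.suc-injective ∘ f-inj) (f[1+i]∈p-f[0] f f-inj f∈p)
    (≤-pred (≤-trans (≤-reflexive (sym (∣p∣≡1+∣p-x∣ (f∈p zero)))) ∣p∣≤1+m))
    (x∈p∧x≢y⇒x∈p-y x∈p x≢f0))

onto⇒∣p∣≤m : (f : Fin m → Fin n) → (∀ {x} → x ∈ p → ∃ λ i → f i ≡ x) → ∣ p ∣ ≤ m
onto⇒∣p∣≤m {m = zero} f onto =
  ≮⇒≥ λ 0<∣p∣ → Fin.¬Fin0 (proj₁ (onto (proj₂ (∣p∣>0⇒nonempty 0<∣p∣))))
onto⇒∣p∣≤m {m = suc m} {p = p} f onto =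
  ≤-trans (∣p∣≤1+∣p-x∣ p (f zero)) (s≤s (onto⇒∣p∣≤m (f ∘ suc) tail-onto))
  where
  tail-onto : ∀ {x} → x ∈ p ─ ⁅ f zero ⁆ → ∃ λ i → f (suc i) ≡ x
  tail-onto x∈p-f0 with onto (p-x⊆p x∈p-f0)
  ... | zero  , refl = contradiction refl (x∈p-y⇒x≢y x∈p-f0)
  ... | suc i , fi≡x = i , fi≡x

enumeration⇒∣p∣≡m : (f : Fin m → Fin n) → Injective _≡_ _≡_ f →
                    (∀ x → x ∈ p ⇔ (∃ λ i → f i ≡ x)) → ∣ p ∣ ≡ m
enumeration⇒∣p∣≡m f f-inj p≡image = ≤-antisym
  (onto⇒∣p∣≤m f (Equivalence.to (p≡image _)))
  (injection⇒m≤∣p∣ f f-inj (λ i → Equivalence.from (p≡image (f i)) (i , refl)))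

lookup-injective : {A : Set} {xs : List A} → Unique xs → Injective _≡_ _≡_ (lookup xs)
lookup-injective (_ ∷ _)          {zero}  {zero}  _       = refl
lookup-injective (x≢xs ∷ _)       {zero}  {suc j} x≡xsⱼ   = contradiction x≡xsⱼ (All.lookup x≢xs (∈-lookup j))
lookup-injective (x≢xs ∷ _)       {suc i} {zero}  xsᵢ≡x   = contradiction (sym xsᵢ≡x) (All.lookup x≢xs (∈-lookup i))
lookup-injective (_ ∷ xs-unique)  {suc i} {suc j} xsᵢ≡xsⱼ = cong suc (lookup-injective xs-unique xsᵢ≡xsⱼ)

unique⇒length≤∣p∣ : {xs : List (Fin n)} → Unique xs → (∀ {x} → x ∈ᴸ xs → x ∈ p) → length xs ≤ ∣ p ∣
unique⇒length≤∣p∣ xs-unique xs⊆p = injection⇒m≤∣p∣ _ (lookup-injective xs-unique) (xs⊆p ∘ ∈-lookup)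

-- Counting subsets

module _ {A : Set} {P Q R : A → Set} (P? : Decidable P) (Q? : Decidable Q) (R? : Decidable R)
         (P⇔Q⊎R : ∀ x → P x ⇔ (Q x ⊎ R x)) (Q∩R≡∅ : ∀ x → Q x → ¬ R x) where

  length-filter-⊎ : ∀ xs → length (filter P? xs) ≡ length (filter Q? xs) + length (filter R? xs)
  length-filter-⊎ []       = refl
  length-filter-⊎ (x ∷ xs) with ih ← length-filter-⊎ xs | P? x | Q? x | R? x
  ... | yes _  | yes _  | no  _  = cong suc ih
  ... | yes _  | no  _  | yes _  = trans (cong suc ih) (sym (+-suc _ _))
  ... | no  _  | no  _  | no  _  = ih
  ... | yes px | no  ¬q | no  ¬r = contradiction (Equivalence.to (P⇔Q⊎R x) px) [ ¬q , ¬r ]′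
  ... | _      | yes qx | yes rx = contradiction rx (Q∩R≡∅ x qx)
  ... | no  ¬p | yes qx | no  _  = contradiction (Equivalence.from (P⇔Q⊎R x) (inj₁ qx)) ¬p
  ... | no  ¬p | no  _  | yes rx = contradiction (Equivalence.from (P⇔Q⊎R x) (inj₂ rx)) ¬p

length-filter-map : {A B : Set} {P : B → Set} (P? : Decidable P) (f : A → B) (xs : List A) →
                    length (filter P? (map f xs)) ≡ length (filter (P? ∘ f) xs)
length-filter-map P? f []       = refl
length-filter-map P? f (x ∷ xs) with does (P? (f x))
... | true  = cong suc (length-filter-map P? f xs)
... | false = length-filter-map P? f xs

count-⊎ : (P? : Decidable P) (Q? : Decidable Q) (R? : Decidable R) →
          (∀ σ → P σ ⇔ (Q σ ⊎ R σ)) → (∀ σ → Q σ → ¬ R σ) → count P? ≡ count Q? + count R?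
count-⊎ P? Q? R? P⇔Q⊎R Q∩R≡∅ = length-filter-⊎ P? Q? R? P⇔Q⊎R Q∩R≡∅ (allSubsets _)

count-cong : (P? : Decidable P) (Q? : Decidable Q) → (∀ σ → P σ ⇔ Q σ) → count P? ≡ count Q?
count-cong P? Q? P⇔Q =
  cong length (filter-≐ P? Q? (Equivalence.to (P⇔Q _) , Equivalence.from (P⇔Q _)) (allSubsets _))

count-none : (P? : Decidable P) → (∀ σ → ¬ P σ) → count P? ≡ 0
count-none P? ∁P = cong length (filter-none P? (universal ∁P (allSubsets _)))

count-size : ∀ n j → count {n} (λ σ → ∣ σ ∣ ≟ j) ≡ n C j
count-size zero    zero    = refl
count-size zero    (suc j) = refl
count-size (suc n) j = begin
  length (filter size? (map (inside ∷_) Sₙ ++ map (outside ∷_) Sₙ))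
    ≡⟨ cong length (filter-++ size? (map (inside ∷_) Sₙ) _) ⟩
  length (filter size? (map (inside ∷_) Sₙ) ++ filter size? (map (outside ∷_) Sₙ))
    ≡⟨ length-++ (filter size? (map (inside ∷_) Sₙ)) ⟩
  length (filter size? (map (inside ∷_) Sₙ)) + length (filter size? (map (outside ∷_) Sₙ))
    ≡⟨ cong₂ _+_ (length-filter-map size? (inside ∷_) Sₙ) (length-filter-map size? (outside ∷_) Sₙ) ⟩
  length (filter (λ σ → suc ∣ σ ∣ ≟ j) Sₙ) + count {n} (λ σ → ∣ σ ∣ ≟ j)
    ≡⟨ pascal j ⟩
  suc n C j ∎
  where
  open ≡-Reasoning
  Sₙ = allSubsets n
  size? : Decidable (λ (σ : Subset (suc n)) → ∣ σ ∣ ≡ j)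
  size? σ = ∣ σ ∣ ≟ j
  pascal : ∀ j → length (filter (λ σ → suc ∣ σ ∣ ≟ j) Sₙ) + count {n} (λ σ → ∣ σ ∣ ≟ j) ≡ suc n C j
  pascal zero    = cong₂ _+_ (cong length (filter-none _ (universal (λ _ ()) Sₙ))) (count-size n 0)
  pascal (suc j) = trans
    (cong₂ _+_ (trans (cong length (filter-≐ _ _ (suc-injective , cong suc) Sₙ)) (count-size n j))
               (count-size n (suc j)))
    (nCk+nC[k+1]≡[n+1]C[k+1] n j)

-- Alternating sums of binomial coefficients

sumTo-vanishing : ∀ {m m′} (g : ℕ → ℤ) → m ≤ m′ → (∀ j → m < j → g j ≡ 0ℤ) → sumTo m′ g ≡ sumTo m g
sumTo-vanishing {m′ = zero} g z≤n _ = refl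
sumTo-vanishing {m} {suc m′} g m≤1+m′ vanishes with m≤n⇒m<n∨m≡n m≤1+m′
... | inj₂ refl       = refl
... | inj₁ (s≤s m≤m′) = begin
  sumTo m′ g ℤ.+ g (suc m′) ≡⟨ cong₂ ℤ._+_ (sumTo-vanishing g m≤m′ vanishes) (vanishes (suc m′) (s≤s m≤m′)) ⟩
  sumTo m g ℤ.+ 0ℤ          ≡⟨ ℤₚ.+-identityʳ (sumTo m g) ⟩
  sumTo m g                 ∎
  where open ≡-Reasoning

sumTo-cong-below : ∀ m (a b : ℕ → ℤ) → (∀ j → j < m → a j ≡ b j) → sumTo m a ≡ sumTo m b ℤ.+ (a m - b m)
sumTo-cong-below zero    a b _   = solve 2 (λ x y → x := y :+ (x :- y)) refl (a 0) (b 0)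
sumTo-cong-below (suc m) a b a≡b = begin
  sumTo m a ℤ.+ a (suc m)
    ≡⟨ cong (ℤ._+ a (suc m)) (sumTo-cong-below m a b (λ j j<m → a≡b j (m<n⇒m<1+n j<m))) ⟩
  sumTo m b ℤ.+ (a m - b m) ℤ.+ a (suc m)
    ≡⟨ cong (λ x → sumTo m b ℤ.+ (x - b m) ℤ.+ a (suc m)) (a≡b m ≤-refl) ⟩
  sumTo m b ℤ.+ (b m - b m) ℤ.+ a (suc m)
    ≡⟨ solve 4 (λ s z x y → s :+ (z :- z) :+ x := (s :+ y) :+ (x :- y)) refl
               (sumTo m b) (b m) (a (suc m)) (b (suc m)) ⟩
  sumTo m b ℤ.+ b (suc m) ℤ.+ (a (suc m) - b (suc m)) ∎
  where open ≡-Reasoning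

+-pascal : ∀ n m → + (suc n C suc m) ≡ + (n C m) ℤ.+ + (n C suc m)
+-pascal n m = trans (cong +_ (sym (nCk+nC[k+1]≡[n+1]C[k+1] n m))) (ℤₚ.pos-+ (n C m) (n C suc m))

alternating-binomial-sum : ∀ n m → sumTo m (λ j → sgn (suc j) ℤ.* + (suc n C j)) ≡ sgn (suc m) ℤ.* + (n C m)
alternating-binomial-sum n zero    = refl
alternating-binomial-sum n (suc m) = begin
  sumTo m (λ j → sgn (suc j) ℤ.* + (suc n C j)) ℤ.+ sgn (suc (suc m)) ℤ.* + (suc n C suc m)
    ≡⟨ cong₂ (λ x y → x ℤ.+ sgn (suc (suc m)) ℤ.* y) (alternating-binomial-sum n m) (+-pascal n m) ⟩
  sgn (suc m) ℤ.* + (n C m) ℤ.+ (- sgn (suc m)) ℤ.* (+ (n C m) ℤ.+ + (n C suc m))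
    ≡⟨ solve 3 (λ s x y → s :* x :+ (:- s) :* (x :+ y) := (:- s) :* y) refl
               (sgn (suc m)) (+ (n C m)) (+ (n C suc m)) ⟩
  sgn (suc (suc m)) ℤ.* + (n C suc m) ∎
  where open ≡-Reasoning

+a≡+c-+b : ∀ {a b c} → a + b ≡ c → + a ≡ + c - + b
+a≡+c-+b {a} {b} {c} a+b≡c = begin
  + a                 ≡⟨ solve 2 (λ x y → x := (x :+ y) :- y) refl (+ a) (+ b) ⟩
  (+ a ℤ.+ + b) - + b ≡⟨ cong (_- + b) (trans (sym (ℤₚ.pos-+ a b)) (cong +_ a+b≡c)) ⟩
  + c - + b           ∎
  where open ≡-Reasoning

alternating-sum : ∀ N e (f : ℕ → ℕ) (Y Z : ℕ) → suc e ≤ N →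
  (∀ j → j < e → f j ≡ N C j) → f e + Y ≡ N C e → f (suc e) + Z ≡ N C suc e → (∀ j → suc e < j → f j ≡ 0) →
  sumTo N (λ j → sgn (suc j) ℤ.* + f j) ≡ sgn e ℤ.* ((+ ((N ∸ 1) C suc e) ℤ.+ + Y) - + Z)
alternating-sum (suc n) e f Y Z 1+e≤N below at-e at-1+e above = begin
  sumTo (suc n) g
    ≡⟨ sumTo-vanishing g 1+e≤N (λ j 1+e<j → trans (cong (λ x → sgn (suc j) ℤ.* + x) (above j 1+e<j))
                                                   (ℤₚ.*-zeroʳ (sgn (suc j)))) ⟩
  sumTo e g ℤ.+ g (suc e)
    ≡⟨ cong (ℤ._+ g (suc e)) (sumTo-cong-below e g b (λ j j<e → cong (λ x → sgn (suc j) ℤ.* + x) (below j j<e))) ⟩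
  sumTo e b ℤ.+ (g e - b e) ℤ.+ g (suc e)
    ≡⟨ cong (λ x → x ℤ.+ (g e - b e) ℤ.+ g (suc e)) (alternating-binomial-sum n e) ⟩
  (- s) ℤ.* c₀ ℤ.+ ((- s) ℤ.* + f e - (- s) ℤ.* c) ℤ.+ (- - s) ℤ.* + f (suc e)
    ≡⟨ cong₂ (λ x y → (- s) ℤ.* c₀ ℤ.+ ((- s) ℤ.* x - (- s) ℤ.* c) ℤ.+ (- - s) ℤ.* y)
             (+a≡+c-+b at-e) (trans (+a≡+c-+b at-1+e) (cong (_- + Z) (+-pascal n e))) ⟩
  (- s) ℤ.* c₀ ℤ.+ ((- s) ℤ.* (c - + Y) - (- s) ℤ.* c) ℤ.+ (- - s) ℤ.* ((c₀ ℤ.+ c₁) - + Z)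
    ≡⟨ solve 6 (λ s x₀ x₁ x y z → (:- s) :* x₀ :+ ((:- s) :* (x :- y) :- (:- s) :* x)
                                    :+ (:- (:- s)) :* ((x₀ :+ x₁) :- z)
                                  := s :* ((x₁ :+ y) :- z))
               refl s c₀ c₁ c (+ Y) (+ Z) ⟩
  s ℤ.* ((c₁ ℤ.+ + Y) - + Z) ∎
  where
  open ≡-Reasoning
  g b : ℕ → ℤ
  g j = sgn (suc j) ℤ.* + f j
  b j = sgn (suc j) ℤ.* + (suc n C j)
  s  = sgn e
  c₀ = + (n C e)
  c₁ = + (n C suc e)
  c  = + (suc n C e)

[n∸1]C[n∸k]≡[n∸1]C[k∸1] : ∀ {n k} → 1 ≤ k → k ≤ n → (n ∸ 1) C (n ∸ k) ≡ (n ∸ 1) C (k ∸ 1)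
[n∸1]C[n∸k]≡[n∸1]C[k∸1] {suc n} {suc k} _ (s≤s k≤n) = sym (nCk≡nC[n∸k] k≤n)

nC[n∸k]≡[n∸1]C[k∸1]+[n∸1]Ck : ∀ {n k} → 1 ≤ k → k ≤ n → n C (n ∸ k) ≡ (n ∸ 1) C (k ∸ 1) + (n ∸ 1) C k
nC[n∸k]≡[n∸1]C[k∸1]+[n∸1]Ck {suc n} {suc k} _ 1+k≤1+n =
  trans (sym (nCk≡nC[n∸k] 1+k≤1+n)) (sym (nCk+nC[k+1]≡[n+1]C[k+1] n k))

-- Walks, simple paths and cycles

module _ {n : ℕ} (G : SimpleGraph n) where

  open import Data.List.Membership.DecPropositional (Fin._≟_ {n}) using () renaming (_∈?_ to _∈ᴸ?_)

  private variable
    A B K S W : Subset n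
    u v w c d : Fin n
    xs : List (Fin n)

  adj⇒≢ : Adj G u v → u ≢ v
  adj⇒≢ uv refl = irrefl G uv

  ReachIn-source : ReachIn G A u v → u ∈ A
  ReachIn-source (here u∈A)     = u∈A
  ReachIn-source (step u∈A _ _) = u∈A

  ReachIn-mono : A ⊆ B → ReachIn G A u v → ReachIn G B u v
  ReachIn-mono A⊆B (here u∈A)         = here (A⊆B u∈A)
  ReachIn-mono A⊆B (step u∈A uw walk) = step (A⊆B u∈A) uw (ReachIn-mono A⊆B walk)

  ReachIn-trans : ReachIn G A u v → ReachIn G A v w → ReachIn G A u w
  ReachIn-trans (here _)           walk′ = walk′
  ReachIn-trans (step u∈A uw walk) walk′ = step u∈A uw (ReachIn-trans walk walk′)

  ReachIn-snoc : ReachIn G A u v → Adj G v w → w ∈ A → ReachIn G A u w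
  ReachIn-snoc (here v∈A)         vw w∈A = step v∈A vw (here w∈A)
  ReachIn-snoc (step u∈A uw walk) vw w∈A = step u∈A uw (ReachIn-snoc walk vw w∈A)

  ReachIn-sym : ReachIn G A u v → ReachIn G A v u
  ReachIn-sym (here u∈A)         = here u∈A
  ReachIn-sym (step u∈A uw walk) = ReachIn-snoc (ReachIn-sym walk) (symm G uw) u∈A

  -- The list index holds the vertices after the first one.
  data SimplePath (A : Subset n) : Fin n → Fin n → List (Fin n) → Set where
    [_]  : u ∈ A → SimplePath A u u []
    step : u ∈ A → Adj G u w → u ∉ᴸ w ∷ xs → SimplePath A w v xs → SimplePath A u v (w ∷ xs)

  path-⊆ : SimplePath A u v xs → x ∈ᴸ u ∷ xs → x ∈ A
  path-⊆ [ u∈A ]          (here refl)  = u∈A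
  path-⊆ (step u∈A _ _ _) (here refl)  = u∈A
  path-⊆ (step _ _ _ p)   (there x∈xs) = path-⊆ p x∈xs

  path-unique : SimplePath A u v xs → Unique (u ∷ xs)
  path-unique [ _ ]           = [] ∷ []
  path-unique (step _ _ u∉ p) = ¬Any⇒All¬ _ u∉ ∷ path-unique p

  path-length : SimplePath A u v xs → suc (length xs) ≤ ∣ A ∣
  path-length p = unique⇒length≤∣p∣ (path-unique p) (path-⊆ p)

  path-nonempty : SimplePath A u v xs → u ≢ v → 0 < length xs
  path-nonempty [ _ ]          u≢u = contradiction refl u≢u
  path-nonempty (step _ _ _ _) _   = s≤s z≤n

  path-suffix : SimplePath A u v xs → x ∈ᴸ xs → ∃ λ ys → SimplePath A x v ys × length ys < length xs
  path-suffix (step _ _ _ p) (here refl)  = _ , p , ≤-refl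
  path-suffix (step _ _ _ p) (there x∈xs) =
    let ys , q , ∣ys∣<∣xs∣ = path-suffix p x∈xs in ys , q , m<n⇒m<1+n ∣ys∣<∣xs∣

  walk⇒path : ReachIn G A u v → ∃ λ xs → SimplePath A u v xs
  walk⇒path (here u∈A) = [] , [ u∈A ]
  walk⇒path {u = u} (step {w = w} u∈A uw walk) with walk⇒path walk
  ... | ys , p with u ∈ᴸ? w ∷ ys
  ...   | no  u∉w∷ys       = w ∷ ys , step u∈A uw u∉w∷ys p
  ...   | yes (here refl)  = ys , p
  ...   | yes (there u∈ys) = let zs , q , _ = path-suffix p u∈ys in zs , q

  path-consec : SimplePath A u v xs → ∀ i → Adj G (lookup (u ∷ xs) (inject₁ i)) (lookup (u ∷ xs) (suc i))
  path-consec (step _ uw _ _) zero    = uw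
  path-consec (step _ _ _ p)  (suc i) = path-consec p i

  path-last : SimplePath A u v xs → lookup (u ∷ xs) (fromℕ (length xs)) ≡ v
  path-last [ _ ]          = refl
  path-last (step _ _ _ p) = path-last p

  close-path : SimplePath A c d xs → u ∉ A → Adj G u c → Adj G u d → c ≢ d → CycleOf G (suc (length xs))
  close-path {c = c} {xs = xs} {u = u} p u∉A uc ud c≢d = record
    { len≥3   = s≤s (s≤s (path-nonempty p c≢d))
    ; vert    = lookup (u ∷ c ∷ xs)
    ; inj     = lookup-injective (All.tabulate u≢path ∷ path-unique p)
    ; consec  = λ { zero → uc ; (suc i) → path-consec p i }
    ; closing = subst (λ x → Adj G x u) (sym (path-last p)) (symm G ud)
    }
    where
    u≢path : x ∈ᴸ c ∷ xs → u ≢ x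
    u≢path x∈path refl = u∉A (path-⊆ p x∈path)

  cycle-length≤n : {m : ℕ} → CycleOf G m → suc m ≤ n
  cycle-length≤n cy = subst (_ ≤_) (∣⊤∣≡n n) (injection⇒m≤∣p∣ (vert cy) (inj cy) (λ _ → ∈⊤))

  segment-reach : {m : ℕ} (f : Fin (suc m) → Fin n) → (∀ i → Adj G (f (inject₁ i)) (f (suc i))) →
                  ∀ {i j} → i ≤ᶠ j → (∀ l → i ≤ᶠ l → l ≤ᶠ j → f l ∈ W) → ReachIn G W (f i) (f j)
  segment-reach f f-adj {zero} {zero} _ f∈W = here (f∈W zero z≤n z≤n)
  segment-reach {m = suc m} f f-adj {zero} {suc j} _ f∈W =
    step (f∈W zero z≤n z≤n) (f-adj zero)
      (segment-reach (f ∘ suc) (f-adj ∘ suc) {zero} {j} z≤n (λ l _ l≤j → f∈W (suc l) z≤n (s≤s l≤j)))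
  segment-reach {m = suc m} f f-adj {suc i} {suc j} (s≤s i≤j) f∈W =
    segment-reach (f ∘ suc) (f-adj ∘ suc) i≤j (λ l i≤l l≤j → f∈W (suc l) (s≤s i≤l) (s≤s l≤j))

  -- All remaining vertices reach a hub along the cycle: vertex 0, or the last vertex if 0 is removed.
  cycle-minus-vertex-connected : {m : ℕ} (cy : CycleOf G m) (i₀ : Fin (suc m)) → vert cy i₀ ∉ W →
    (∀ i → i ≢ i₀ → vert cy i ∈ W) → (∀ {x} → x ∈ W → ∃ λ i → vert cy i ≡ x) → Connected G W
  cycle-minus-vertex-connected {W = W} {m = m} cy i₀ f-i₀∉W f∈W W⊆cy x y x∈W y∈W
    with i , refl ← W⊆cy x∈W | j , refl ← W⊆cy y∈W =
    let h , to-h = to-hub in ReachIn-trans (to-h i (≢i₀ x∈W)) (ReachIn-sym (to-h j (≢i₀ y∈W)))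
    where
    f = vert cy

    ≢i₀ : ∀ {i} → f i ∈ W → i ≢ i₀
    ≢i₀ f-i∈W refl = f-i₀∉W f-i∈W

    up-to-last : ∀ i → i₀ <ᶠ i → ReachIn G W (f i) (f (fromℕ m))
    up-to-last i i₀<i = segment-reach f (consec cy) (Fin.≤fromℕ i)
      (λ l i≤l _ → f∈W l (≢-sym (Fin.<⇒≢ (<-≤-trans i₀<i i≤l))))

    down-to-first : ∀ i → i <ᶠ i₀ → ReachIn G W (f i) (f zero)
    down-to-first i i<i₀ = ReachIn-sym (segment-reach f (consec cy) z≤n
      (λ l _ l≤i → f∈W l (Fin.<⇒≢ (≤-<-trans l≤i i<i₀))))

    to-first : zero ≢ i₀ → ∀ i → i ≢ i₀ → ReachIn G W (f i) (f zero)
    to-first 0≢i₀ i i≢i₀ with Fin.<-cmp i i₀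
    ... | tri< i<i₀ _ _ = down-to-first i i<i₀
    ... | tri≈ _ i≡i₀ _ = contradiction i≡i₀ i≢i₀
    ... | tri> _ _ i₀<i = ReachIn-snoc (up-to-last i i₀<i) (closing cy) (f∈W zero 0≢i₀)

    to-last : zero ≡ i₀ → ∀ i → i ≢ i₀ → ReachIn G W (f i) (f (fromℕ m))
    to-last refl zero    0≢0 = contradiction refl 0≢0
    to-last refl (suc i) _   = up-to-last (suc i) (s≤s z≤n)

    to-hub : ∃ λ h → ∀ i → i ≢ i₀ → ReachIn G W (f i) h
    to-hub with zero Fin.≟ i₀
    ... | yes 0≡i₀ = f (fromℕ m) , to-last 0≡i₀
    ... | no  0≢i₀ = f zero , to-first 0≢i₀

  connected⇒neighbour : Connected G A → u ∈ A → 2 ≤ ∣ A ∣ → ∃ λ w → Adj G u w × w ∈ A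
  connected⇒neighbour {A = A} {u = u} A-conn u∈A 2≤∣A∣
    with v , v∈A-u ← ∣p∣>0⇒nonempty {p = A ─ ⁅ u ⁆} (≤-pred (≤-trans 2≤∣A∣ (≤-reflexive (∣p∣≡1+∣p-x∣ u∈A))))
    with A-conn u v u∈A (p-x⊆p v∈A-u)
  ... | here _         = contradiction refl (x∈p-y⇒x≢y v∈A-u)
  ... | step _ uw walk = _ , uw , ReachIn-source walk

  TwoNeighbours : Fin n → Subset n → Set
  TwoNeighbours u B = ∃₂ λ c d → c ≢ d × (Adj G u c × c ∈ B) × (Adj G u d × d ∈ B)

  record Claw (u : Fin n) : Set where
    field
      c₁ c₂ c₃ : Fin n
      u-c₁  : Adj G u c₁
      u-c₂  : Adj G u c₂
      u-c₃  : Adj G u c₃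
      c₁≢c₂ : c₁ ≢ c₂
      c₁≢c₃ : c₁ ≢ c₃
      c₂≢c₃ : c₂ ≢ c₃

    leaves : Subset n
    leaves = ⁅ c₁ ⁆ ∪ ⁅ c₂ ⁆ ∪ ⁅ c₃ ⁆

  claw⇒short-cycle : Connected G K → u ∉ K → (claw : Claw u) → Claw.leaves claw ⊆ K →
                     ∃ λ ℓ → ℓ ≤ ∣ K ∣ × HasCycleOfLength G ℓ
  claw⇒short-cycle {K = K} {u = u} K-conn u∉K claw leaves⊆K = close (walk⇒path (K-conn c₁ c₂ c₁∈K c₂∈K))
    where
    open Claw claw
    c₁∈K = leaves⊆K (x∈p∪q⁺ (inj₁ (x∈⁅x⁆ c₁)))
    c₂∈K = leaves⊆K (x∈p∪q⁺ (inj₂ (x∈p∪q⁺ (inj₁ (x∈⁅x⁆ c₂)))))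
    c₃∈K = leaves⊆K (x∈p∪q⁺ (inj₂ (x∈p∪q⁺ (inj₂ (x∈⁅x⁆ c₃)))))

    close : (∃ λ xs → SimplePath K c₁ c₂ xs) → ∃ λ ℓ → ℓ ≤ ∣ K ∣ × HasCycleOfLength G ℓ
    close (xs , p) with c₃ ∈ᴸ? xs
    ... | yes c₃∈xs with zs , q , ∣zs∣<∣xs∣ ← path-suffix p c₃∈xs =
      _ , ≤-trans (s≤s ∣zs∣<∣xs∣) (path-length p) , close-path q u∉K u-c₃ u-c₂ (≢-sym c₂≢c₃)
    ... | no c₃∉xs =
      _ , unique⇒length≤∣p∣ (¬Any⇒All¬ _ c₃∉c₁∷xs ∷ path-unique p) c₃∷c₁∷xs⊆K ,
      close-path p u∉K u-c₁ u-c₂ c₁≢c₂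
      where
      c₃∉c₁∷xs : c₃ ∉ᴸ c₁ ∷ xs
      c₃∉c₁∷xs (here c₃≡c₁)  = c₁≢c₃ (sym c₃≡c₁)
      c₃∉c₁∷xs (there c₃∈xs) = c₃∉xs c₃∈xs
      c₃∷c₁∷xs⊆K : ∀ {x} → x ∈ᴸ c₃ ∷ c₁ ∷ xs → x ∈ K
      c₃∷c₁∷xs⊆K (here refl)     = c₃∈K
      c₃∷c₁∷xs⊆K (there x∈c₁∷xs) = path-⊆ p x∈c₁∷xs

  module _ (k : ℕ) where

    private variable
      σ F : Subset n

    -- Complements of non-faces

    NoShortCycles : Set
    NoShortCycles = ∀ ℓ → ℓ ≤ k → ¬ HasCycleOfLength G ℓ

    no-short-cycles⇒k≤m : NoShortCycles → {m : ℕ} → CycleOf G m → k ≤ m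
    no-short-cycles⇒k≤m no-short cy = ≮⇒≥ (λ m<k → no-short _ m<k cy)

    -- Doubly negated because it is derived from ¬ IsFace, and Connected is not decidable.
    SubsetsConnected : Subset n → Set
    SubsetsConnected S = ∀ A → A ⊆ S → ∣ A ∣ ≡ k → ¬ ¬ Connected G A

    SubsetsConnected-⊆ : B ⊆ S → SubsetsConnected S → SubsetsConnected B
    SubsetsConnected-⊆ B⊆S S-conn A A⊆B = S-conn A (B⊆S ∘ A⊆B)

    non-face⇒SubsetsConnected : ¬ IsFace G k σ → SubsetsConnected (∁ σ)
    non-face⇒SubsetsConnected {σ = σ} ¬face A A⊆∁σ ∣A∣≡k A-disconnected =
      ¬face (∁ A , (∣A∣≡k⇒∣∁A∣≡n∸k , subst (Disconnected G) (sym (∁-involutive A)) A-disconnected) , σ⊆∁A)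
      where
      ∣A∣≡k⇒∣∁A∣≡n∸k = trans (∣∁p∣≡n∸∣p∣ A) (cong (n ∸_) ∣A∣≡k)
      σ⊆∁A : σ ⊆ ∁ A
      σ⊆∁A x∈σ = x∉p⇒x∈∁p λ x∈A → x∈∁p⇒x∉p (A⊆∁σ x∈A) x∈σ

    two-neighbours-exact : 2 ≤ k → SubsetsConnected B → ∣ B ∣ ≡ suc k → u ∈ B → ¬ ¬ TwoNeighbours u B
    two-neighbours-exact {B = B} {u = u} 2≤k B-conn ∣B∣≡1+k u∈B
      with v , v∈B-u ← ∣p∣>0⇒nonempty {p = B ─ ⁅ u ⁆}
                         (≤-trans (s≤s z≤n) (≤-trans 2≤k (≤-reflexive (sym (∣p-x∣≡m u∈B ∣B∣≡1+k))))) = do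
      (c , uc , c∈B-v) ← neighbour-avoiding (p-x⊆p v∈B-u) (≢-sym (x∈p-y⇒x≢y v∈B-u))
      (d , ud , d∈B-c) ← neighbour-avoiding (p-x⊆p c∈B-v) (adj⇒≢ uc)
      pure (c , d , ≢-sym (x∈p-y⇒x≢y d∈B-c) , (uc , p-x⊆p c∈B-v) , (ud , p-x⊆p d∈B-c))
      where
      neighbour-avoiding : ∀ {x} → x ∈ B → u ≢ x → ¬ ¬ (∃ λ w → Adj G u w × w ∈ B ─ ⁅ x ⁆)
      neighbour-avoiding {x} x∈B u≢x = do
        B-x-conn ← B-conn (B ─ ⁅ x ⁆) p-x⊆p ∣B-x∣≡k
        pure (connected⇒neighbour B-x-conn (x∈p∧x≢y⇒x∈p-y u∈B u≢x) (≤-trans 2≤k (≤-reflexive (sym ∣B-x∣≡k))))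
        where
        ∣B-x∣≡k = ∣p-x∣≡m x∈B ∣B∣≡1+k

    two-neighbours : 2 ≤ k → SubsetsConnected B → suc k ≤ ∣ B ∣ → u ∈ B → ¬ ¬ TwoNeighbours u B
    two-neighbours {u = u} 2≤k B-conn 1+k≤∣B∣ u∈B
      with B′ , ⁅u⁆⊆B′ , B′⊆B , ∣B′∣≡1+k ←
             subset-of-size (x∈p⇒⁅x⁆⊆p u∈B) (≤-trans (≤-reflexive (∣⁅x⁆∣≡1 u)) (s≤s z≤n)) 1+k≤∣B∣ = do
      (c , d , c≢d , (uc , c∈B′) , (ud , d∈B′)) ←
        two-neighbours-exact 2≤k (SubsetsConnected-⊆ B′⊆B B-conn) ∣B′∣≡1+k (⁅u⁆⊆B′ (x∈⁅x⁆ u))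
      pure (c , d , c≢d , (uc , B′⊆B c∈B′) , (ud , B′⊆B d∈B′))

    cycle-in-∁σ⇒InY : {m : ℕ} (cy : CycleOf G m) → (∀ i → vert cy i ∈ ∁ σ) → ∣ ∁ σ ∣ ≡ suc k → k ≤ m →
                      InY G k σ
    cycle-in-∁σ⇒InY cy cy⊆∁σ ∣∁σ∣≡1+k k≤m
      with refl ← ≤-antisym (≤-pred (≤-trans (injection⇒m≤∣p∣ (vert cy) (inj cy) cy⊆∁σ)
                                              (≤-reflexive ∣∁σ∣≡1+k)))
                            k≤m =
      cy , λ x → mk⇔ (injection∧∣p∣≤m⇒onto (vert cy) (inj cy) cy⊆∁σ (≤-reflexive ∣∁σ∣≡1+k))
                     λ { (i , refl) → cy⊆∁σ i }

    spanning-cycle : 2 ≤ k → NoShortCycles → SubsetsConnected (∁ σ) → ∣ ∁ σ ∣ ≡ suc k → ¬ ¬ InY G k σ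
    spanning-cycle {σ = σ} 2≤k no-short S-conn ∣S∣≡1+k
      with u , u∈S ← ∣p∣>0⇒nonempty (≤-trans (s≤s z≤n) (≤-reflexive (sym ∣S∣≡1+k))) = do
      (c , d , c≢d , (uc , c∈S) , (ud , d∈S)) ← two-neighbours 2≤k S-conn (≤-reflexive (sym ∣S∣≡1+k)) u∈S
      S-u-conn ← S-conn (∁ σ ─ ⁅ u ⁆) p-x⊆p (∣p-x∣≡m u∈S ∣S∣≡1+k)
      pure (close-in-S (walk⇒path (S-u-conn c d (∈S-u c∈S uc) (∈S-u d∈S ud))) uc ud c≢d)
      where
      ∈S-u : c ∈ ∁ σ → Adj G u c → c ∈ ∁ σ ─ ⁅ u ⁆
      ∈S-u c∈S u-c = x∈p∧x≢y⇒x∈p-y c∈S (≢-sym (adj⇒≢ u-c))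

      close-in-S : (∃ λ xs → SimplePath (∁ σ ─ ⁅ u ⁆) c d xs) → Adj G u c → Adj G u d → c ≢ d → InY G k σ
      close-in-S (xs , p) uc ud c≢d = cycle-in-∁σ⇒InY cy cy⊆S ∣S∣≡1+k (no-short-cycles⇒k≤m no-short cy)
        where
        cy = close-path p (λ u∈S-u → x∈p-y⇒x≢y u∈S-u refl) uc ud c≢d
        cy⊆S : ∀ i → vert cy i ∈ ∁ σ
        cy⊆S zero    = u∈S
        cy⊆S (suc i) = p-x⊆p (path-⊆ p (∈-lookup i))

    claw-in-large : 2 ≤ k → SubsetsConnected S → suc (suc k) ≤ ∣ S ∣ → u ∈ S →
                    ¬ ¬ (Σ (Claw u) λ claw → Claw.leaves claw ⊆ S ─ ⁅ u ⁆)
    claw-in-large {S = S} {u = u} 2≤k S-conn k+2≤∣S∣ u∈S = do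
      (c₁ , _ , _ , (u-c₁ , c₁∈S) , _) ← two-neighbours 2≤k S-conn (<⇒≤ k+2≤∣S∣) u∈S
      let k+1≤∣S-c₁∣ = ≤-pred (≤-trans k+2≤∣S∣ (≤-reflexive (∣p∣≡1+∣p-x∣ c₁∈S)))
          u∈S-c₁     = x∈p∧x≢y⇒x∈p-y u∈S (adj⇒≢ u-c₁)
      (c₂ , c₃ , c₂≢c₃ , (u-c₂ , c₂∈S-c₁) , (u-c₃ , c₃∈S-c₁)) ←
        two-neighbours 2≤k (SubsetsConnected-⊆ p-x⊆p S-conn) k+1≤∣S-c₁∣ u∈S-c₁
      pure ( record { u-c₁  = u-c₁ ; u-c₂ = u-c₂ ; u-c₃ = u-c₃
                    ; c₁≢c₂ = ≢-sym (x∈p-y⇒x≢y c₂∈S-c₁)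
                    ; c₁≢c₃ = ≢-sym (x∈p-y⇒x≢y c₃∈S-c₁)
                    ; c₂≢c₃ = c₂≢c₃ }
           , λ {x} → ⁅x⁆∪⁅y⁆∪⁅z⁆⊆p (∈S-u c₁∈S u-c₁) (∈S-u (p-x⊆p c₂∈S-c₁) u-c₂) (∈S-u (p-x⊆p c₃∈S-c₁) u-c₃) )
      where
      ∈S-u : c ∈ S → Adj G u c → c ∈ S ─ ⁅ u ⁆
      ∈S-u c∈S u-c = x∈p∧x≢y⇒x∈p-y c∈S (≢-sym (adj⇒≢ u-c))

    SubsetsConnected-large⇒⊥ : 3 ≤ k → NoShortCycles → SubsetsConnected S → suc (suc k) ≤ ∣ S ∣ → ⊥
    SubsetsConnected-large⇒⊥ {S = S} 3≤k no-short S-conn k+2≤∣S∣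
      with u , u∈S ← ∣p∣>0⇒nonempty (≤-trans (s≤s z≤n) k+2≤∣S∣) =
      claw-in-large (<⇒≤ 3≤k) S-conn k+2≤∣S∣ u∈S no-claw
      where
      k≤∣S-u∣ : k ≤ ∣ S ─ ⁅ u ⁆ ∣
      k≤∣S-u∣ = <⇒≤ (≤-pred (≤-trans k+2≤∣S∣ (≤-reflexive (∣p∣≡1+∣p-x∣ u∈S))))

      no-claw : (Σ (Claw u) λ claw → Claw.leaves claw ⊆ S ─ ⁅ u ⁆) → ⊥
      no-claw (claw , leaves⊆S-u) =
        short-cycle-in (subset-of-size leaves⊆S-u (≤-trans (∣⁅x⁆∪⁅y⁆∪⁅z⁆∣≤3 c₁ c₂ c₃) 3≤k) k≤∣S-u∣)
        where
        open Claw claw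

        short-cycle-in : (∃ λ K → leaves ⊆ K × K ⊆ S ─ ⁅ u ⁆ × ∣ K ∣ ≡ k) → ⊥
        short-cycle-in (K , leaves⊆K , K⊆S-u , ∣K∣≡k) = S-conn K (p-x⊆p ∘ K⊆S-u) ∣K∣≡k λ K-conn →
          no-short-cycle (claw⇒short-cycle K-conn (λ u∈K → x∈p-y⇒x≢y (K⊆S-u u∈K) refl) claw leaves⊆K)
          where
          no-short-cycle : (∃ λ ℓ → ℓ ≤ ∣ K ∣ × HasCycleOfLength G ℓ) → ⊥
          no-short-cycle (ℓ , ℓ≤∣K∣ , cy) = no-short ℓ (≤-trans ℓ≤∣K∣ (≤-reflexive ∣K∣≡k)) cy

    -- Faces of Δ_k(G)

    ∣F∣≡n∸k⇒∣∁F∣≡k : (F : Subset n) → k ≤ n → ∣ F ∣ ≡ n ∸ k → ∣ ∁ F ∣ ≡ k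
    ∣F∣≡n∸k⇒∣∁F∣≡k F k≤n ∣F∣≡n∸k = trans (∣∁p∣≡n∸∣p∣ F) (trans (cong (n ∸_) ∣F∣≡n∸k) (m∸[m∸n]≡n k≤n))

    InZ⇒size : InZ G k σ → ∣ σ ∣ ≡ n ∸ k
    InZ⇒size (A , ∣A∣≡k , _ , refl) = trans (∣∁p∣≡n∸∣p∣ A) (cong (n ∸_) ∣A∣≡k)

    InY⇒∣∁σ∣≡1+k : InY G k σ → ∣ ∁ σ ∣ ≡ suc k
    InY⇒∣∁σ∣≡1+k (cy , ∁σ≡cy) = enumeration⇒∣p∣≡m (vert cy) (inj cy) ∁σ≡cy

    InY⇒size : InY G k σ → ∣ σ ∣ ≡ n ∸ suc k
    InY⇒size {σ = σ} σ∈Y = trans (∣p∣≡n∸∣∁p∣ σ) (cong (n ∸_) (InY⇒∣∁σ∣≡1+k σ∈Y))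

    face⇒size : IsFace G k σ → ∣ σ ∣ ≤ n ∸ k
    face⇒size (F , (∣F∣≡n∸k , _) , σ⊆F) = subst (_ ≤_) ∣F∣≡n∸k (p⊆q⇒∣p∣≤∣q∣ σ⊆F)

    face⇒∉Z : k ≤ n → IsFace G k σ → ¬ InZ G k σ
    face⇒∉Z k≤n (F , (∣F∣≡n∸k , ∁F-disconnected) , ∁A⊆F) (A , ∣A∣≡k , A-connected , refl) =
      ∁F-disconnected λ x y x∈∁F y∈∁F → ReachIn-mono A⊆∁F (A-connected x y (∁F⊆A x∈∁F) (∁F⊆A y∈∁F))
      where
      ∁F⊆A : ∁ F ⊆ A
      ∁F⊆A = subst (∁ F ⊆_) (∁-involutive A) (p⊆q⇒∁p⊇∁q ∁A⊆F)
      A⊆∁F : A ⊆ ∁ F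
      A⊆∁F = p⊆q∧∣q∣≤∣p∣⇒q⊆p ∁F⊆A (≤-reflexive (trans ∣A∣≡k (sym (∣F∣≡n∸k⇒∣∁F∣≡k F k≤n ∣F∣≡n∸k))))

    face⇒∉Y : k ≤ n → IsFace G k σ → ¬ InY G k σ
    face⇒∉Y {σ = σ} k≤n (F , (∣F∣≡n∸k , ∁F-disconnected) , σ⊆F) σ∈Y@(cy , ∁σ≡cy) =
      ∁F-disconnected ∁F-connected
      where
      ∁F⊆∁σ : ∁ F ⊆ ∁ σ
      ∁F⊆∁σ = p⊆q⇒∁p⊇∁q σ⊆F
      ∣∁F∣≡k = ∣F∣≡n∸k⇒∣∁F∣≡k F k≤n ∣F∣≡n∸k
      cy⊆∁σ : ∀ i → vert cy i ∈ ∁ σ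
      cy⊆∁σ i = Equivalence.from (∁σ≡cy _) (i , refl)

      missing : ∃ λ i₀ → vert cy i₀ ∉ ∁ F
      missing with Fin.all? (λ i → vert cy i ∈? ∁ F)
      ... | yes cy⊆∁F = contradiction (injection⇒m≤∣p∣ (vert cy) (inj cy) cy⊆∁F) (<⇒≱ (s≤s (≤-reflexive ∣∁F∣≡k)))
      ... | no  cy⊈∁F = Fin.¬∀⟶∃¬ _ _ (λ i → vert cy i ∈? ∁ F) cy⊈∁F

      ∁F-connected : Connected G (∁ F)
      ∁F-connected with i₀ , cyᵢ₀∉∁F ← missing =
        cycle-minus-vertex-connected cy i₀ cyᵢ₀∉∁F others∈∁F (Equivalence.to (∁σ≡cy _) ∘ ∁F⊆∁σ)
        where
        ∁F⊆∁σ-cyᵢ₀ : ∁ F ⊆ ∁ σ ─ ⁅ vert cy i₀ ⁆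
        ∁F⊆∁σ-cyᵢ₀ x∈∁F = x∈p∧x≢y⇒x∈p-y (∁F⊆∁σ x∈∁F) λ { refl → cyᵢ₀∉∁F x∈∁F }
        ∣∁σ-cyᵢ₀∣≡k = ∣p-x∣≡m (cy⊆∁σ i₀) (InY⇒∣∁σ∣≡1+k σ∈Y)
        others∈∁F : ∀ i → i ≢ i₀ → vert cy i ∈ ∁ F
        others∈∁F i i≢i₀ = p⊆q∧∣q∣≤∣p∣⇒q⊆p ∁F⊆∁σ-cyᵢ₀ (≤-reflexive (trans ∣∁σ-cyᵢ₀∣≡k (sym ∣∁F∣≡k)))
                             (x∈p∧x≢y⇒x∈p-y (cy⊆∁σ i) (i≢i₀ ∘ inj cy))

    module FaceLattice (3≤k : 3 ≤ k) (no-short : NoShortCycles) (k<n : k < n) (face? : Decidable (IsFace G k))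
      where

      k≤n : k ≤ n
      k≤n = <⇒≤ k<n

      face-intro : ∣ σ ∣ ≤ n ∸ k → ¬ InZ G k σ → ¬ InY G k σ → IsFace G k σ
      face-intro {σ = σ} ∣σ∣≤n∸k σ∉Z σ∉Y with face? σ
      ... | yes face = face
      ... | no ¬face = ⊥-elim (by-size (m≤n⇒m<n∨m≡n k≤∣∁σ∣))
        where
        ∁σ-connected = non-face⇒SubsetsConnected ¬face

        k≤∣∁σ∣ : k ≤ ∣ ∁ σ ∣
        k≤∣∁σ∣ = begin
          k           ≡⟨ m∸[m∸n]≡n k≤n ⟨
          n ∸ (n ∸ k) ≤⟨ ∸-monoʳ-≤ n ∣σ∣≤n∸k ⟩
          n ∸ ∣ σ ∣   ≡⟨ ∣∁p∣≡n∸∣p∣ σ ⟨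
          ∣ ∁ σ ∣     ∎
          where open ≤-Reasoning

        by-size : k < ∣ ∁ σ ∣ ⊎ k ≡ ∣ ∁ σ ∣ → ⊥
        by-size (inj₂ k≡∣∁σ∣) = ∁σ-connected (∁ σ) id (sym k≡∣∁σ∣) λ ∁σ-conn →
          σ∉Z (∁ σ , sym k≡∣∁σ∣ , ∁σ-conn , sym (∁-involutive σ))
        by-size (inj₁ k<∣∁σ∣) with m≤n⇒m<n∨m≡n k<∣∁σ∣
        ... | inj₂ 1+k≡∣∁σ∣ = spanning-cycle (<⇒≤ 3≤k) no-short ∁σ-connected (sym 1+k≡∣∁σ∣) σ∉Y
        ... | inj₁ 1+k<∣∁σ∣ = SubsetsConnected-large⇒⊥ 3≤k no-short ∁σ-connected 1+k<∣∁σ∣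

      face⇔ : ∀ σ → IsFace G k σ ⇔ ((∣ σ ∣ ≤ n ∸ k) × ¬ InZ G k σ × ¬ InY G k σ)
      face⇔ σ = mk⇔ (λ face → face⇒size face , face⇒∉Z k≤n face , face⇒∉Y k≤n face)
                    (λ (∣σ∣≤n∸k , σ∉Z , σ∉Y) → face-intro ∣σ∣≤n∸k σ∉Z σ∉Y)

      small⇒face : ∀ σ → ∣ σ ∣ + k + 2 ≤ n → IsFace G k σ
      small⇒face σ small = face-intro (<⇒≤ ∣σ∣<n∸k)
        (λ σ∈Z → <⇒≢ ∣σ∣<n∸k (InZ⇒size σ∈Z))
        (λ σ∈Y → <⇒≢ ∣σ∣<n∸1+k (InY⇒size σ∈Y))
        where
        ∣σ∣<n∸1+k : ∣ σ ∣ < n ∸ suc k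
        ∣σ∣<n∸1+k = m+n≤o⇒m≤o∸n (suc ∣ σ ∣)
          (subst (_≤ n) (trans (+-assoc ∣ σ ∣ k 2) (trans (cong (_+_ ∣ σ ∣) (+-comm k 2)) (+-suc ∣ σ ∣ (suc k))))
                 small)
        ∣σ∣<n∸k : ∣ σ ∣ < n ∸ k
        ∣σ∣<n∸k = <-≤-trans ∣σ∣<n∸1+k (∸-monoʳ-≤ n (n≤1+n k))

      -- Face numbers

      module FaceCounts (facet? : Decidable (IsFacet G k)) (Z? : Decidable (InZ G k)) (Y? : Decidable (InY G k))
        where

        private
          f : ℕ → ℕ
          f = faceCountOfSize face?
          1≤k : 1 ≤ k
          1≤k = ≤-trans (s≤s z≤n) 3≤k

        e : ℕ
        e = n ∸ k ∸ 1

        1+e≡n∸k : suc e ≡ n ∸ k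
        1+e≡n∸k = m+[n∸m]≡n (m<n⇒0<n∸m k<n)

        e<n∸k : e < n ∸ k
        e<n∸k = ≤-reflexive 1+e≡n∸k

        InY⇒∣σ∣≡e : InY G k σ → ∣ σ ∣ ≡ e
        InY⇒∣σ∣≡e σ∈Y = trans (InY⇒size σ∈Y) (sym (trans (∸-+-assoc n k 1) (cong (n ∸_) (+-comm k 1))))

        faces-below : ∀ j → j < e → f j ≡ n C j
        faces-below j j<e = trans
          (count-cong (λ σ → face? σ ×-dec (∣ σ ∣ ≟ j)) (λ σ → ∣ σ ∣ ≟ j)
                      (λ σ → mk⇔ proj₂ (λ ∣σ∣≡j → small-face {σ} ∣σ∣≡j , ∣σ∣≡j)))
          (count-size n j)
          where
          j<n∸k : j < n ∸ k
          j<n∸k = <-trans j<e e<n∸k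
          small-face : ∣ σ ∣ ≡ j → IsFace G k σ
          small-face refl = face-intro (<⇒≤ j<n∸k)
            (λ σ∈Z → <⇒≢ j<n∸k (InZ⇒size σ∈Z)) (λ σ∈Y → <⇒≢ j<e (InY⇒∣σ∣≡e σ∈Y))

        faces+count≡binomial : {R : Subset n → Set} (R? : Decidable R) (j : ℕ) → (∀ {σ} → R σ → ∣ σ ∣ ≡ j) →
          (∀ {σ} → IsFace G k σ → ¬ R σ) → (∀ {σ} → ∣ σ ∣ ≡ j → ¬ R σ → IsFace G k σ) →
          f j + count R? ≡ n C j
        faces+count≡binomial {R} R? j R⇒∣σ∣≡j face⇒∉R ∉R⇒face = trans
          (sym (count-⊎ (λ σ → ∣ σ ∣ ≟ j) (λ σ → face? σ ×-dec (∣ σ ∣ ≟ j)) R? split (λ σ → face⇒∉R ∘ proj₁)))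
          (count-size n j)
          where
          classify : ∀ {σ} → ∣ σ ∣ ≡ j → (IsFace G k σ × ∣ σ ∣ ≡ j) ⊎ R σ
          classify {σ} ∣σ∣≡j with R? σ
          ... | yes σ∈R = inj₂ σ∈R
          ... | no  σ∉R = inj₁ (∉R⇒face ∣σ∣≡j σ∉R , ∣σ∣≡j)
          split : ∀ σ → ∣ σ ∣ ≡ j ⇔ ((IsFace G k σ × ∣ σ ∣ ≡ j) ⊎ R σ)
          split σ = mk⇔ classify [ proj₂ , R⇒∣σ∣≡j ]′

        faces+Y : f e + count Y? ≡ n C e
        faces+Y = faces+count≡binomial Y? e InY⇒∣σ∣≡e (face⇒∉Y k≤n) λ ∣σ∣≡e σ∉Y →
          face-intro (<⇒≤ (subst (_< n ∸ k) (sym ∣σ∣≡e) e<n∸k))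
                     (λ σ∈Z → <⇒≢ e<n∸k (trans (sym ∣σ∣≡e) (InZ⇒size σ∈Z))) σ∉Y

        faces+Z : f (suc e) + count Z? ≡ n C suc e
        faces+Z = faces+count≡binomial Z? (suc e) (λ σ∈Z → trans (InZ⇒size σ∈Z) (sym 1+e≡n∸k)) (face⇒∉Z k≤n)
          λ ∣σ∣≡1+e σ∉Z → face-intro (≤-reflexive (trans ∣σ∣≡1+e 1+e≡n∸k)) σ∉Z
                                     (λ σ∈Y → <⇒≢ (n<1+n e) (trans (sym (InY⇒∣σ∣≡e σ∈Y)) ∣σ∣≡1+e))

        faces-above : ∀ j → suc e < j → f j ≡ 0
        faces-above j 1+e<j = count-none (λ σ → face? σ ×-dec (∣ σ ∣ ≟ j)) λ σ (face , ∣σ∣≡j) →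
          <⇒≱ 1+e<j (subst₂ _≤_ ∣σ∣≡j (sym 1+e≡n∸k) (face⇒size face))

        facets+Z : count facet? + count Z? ≡ n C (n ∸ k)
        facets+Z = trans (sym (count-⊎ (λ σ → ∣ σ ∣ ≟ n ∸ k) facet? Z? split facet⇒∉Z)) (count-size n (n ∸ k))
          where
          classify : ∀ {σ} → ∣ σ ∣ ≡ n ∸ k → IsFacet G k σ ⊎ InZ G k σ
          classify {σ} ∣σ∣≡n∸k with Z? σ
          ... | yes σ∈Z = inj₂ σ∈Z
          ... | no  σ∉Z = inj₁ (∣σ∣≡n∸k , λ ∁σ-connected →
            σ∉Z (∁ σ , ∣F∣≡n∸k⇒∣∁F∣≡k σ k≤n ∣σ∣≡n∸k , ∁σ-connected , sym (∁-involutive σ)))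
          split : ∀ σ → ∣ σ ∣ ≡ n ∸ k ⇔ (IsFacet G k σ ⊎ InZ G k σ)
          split σ = mk⇔ classify [ proj₁ , InZ⇒size ]′
          facet⇒∉Z : ∀ σ → IsFacet G k σ → ¬ InZ G k σ
          facet⇒∉Z σ facet = face⇒∉Z k≤n (σ , facet , id)

        reducedEuler≡Y-Z : reducedEuler face? ≡ sgn e ℤ.* ((+ ((n ∸ 1) C (k ∸ 1)) ℤ.+ + count Y?) - + count Z?)
        reducedEuler≡Y-Z = begin
          reducedEuler face?
            ≡⟨ alternating-sum n e f (count Y?) (count Z?) 1+e≤n faces-below faces+Y faces+Z faces-above ⟩
          sgn e ℤ.* ((+ ((n ∸ 1) C suc e) ℤ.+ + count Y?) - + count Z?)
            ≡⟨ cong (λ c → sgn e ℤ.* ((+ c ℤ.+ + count Y?) - + count Z?)) [n∸1]C[1+e]≡[n∸1]C[k∸1] ⟩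
          sgn e ℤ.* ((+ ((n ∸ 1) C (k ∸ 1)) ℤ.+ + count Y?) - + count Z?) ∎
          where
          open ≡-Reasoning
          1+e≤n : suc e ≤ n
          1+e≤n = subst (_≤ n) (sym 1+e≡n∸k) (m∸n≤m n k)
          [n∸1]C[1+e]≡[n∸1]C[k∸1] : (n ∸ 1) C suc e ≡ (n ∸ 1) C (k ∸ 1)
          [n∸1]C[1+e]≡[n∸1]C[k∸1] = trans (cong ((n ∸ 1) C_) 1+e≡n∸k) ([n∸1]C[n∸k]≡[n∸1]C[k∸1] 1≤k k≤n)

        reducedEuler≡facets : reducedEuler face? ≡ sgn e ℤ.* ((+ count facet? - + ((n ∸ 1) C k)) ℤ.+ + count Y?)
        reducedEuler≡facets = trans reducedEuler≡Y-Z (cong (sgn e ℤ.*_) (begin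
          (+ a ℤ.+ + count Y?) - + count Z?
            ≡⟨ solve 4 (λ a b y z → (a :+ y) :- z := (((a :+ b) :- z) :- b) :+ y) refl
                       (+ a) (+ b) (+ count Y?) (+ count Z?) ⟩
          (((+ a ℤ.+ + b) - + count Z?) - + b) ℤ.+ + count Y?
            ≡⟨ cong (λ x → (x - + b) ℤ.+ + count Y?) facets≡ ⟨
          (+ count facet? - + b) ℤ.+ + count Y? ∎))
          where
          open ≡-Reasoning
          a = (n ∸ 1) C (k ∸ 1)
          b = (n ∸ 1) C k
          facets≡ : + count facet? ≡ (+ a ℤ.+ + b) - + count Z?
          facets≡ = trans (+a≡+c-+b (trans facets+Z (nC[n∸k]≡[n∸1]C[k∸1]+[n∸1]Ck 1≤k k≤n)))
                          (cong (_- + count Z?) (ℤₚ.pos-+ a b))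

proposition2p18 : (n : ℕ) (G : SimpleGraph n) (k : ℕ) → 3 ≤ k →
    (∀ ℓ → ℓ ≤ k → ¬ HasCycleOfLength G ℓ) →
    HasCycleOfLength G (suc k) →
    (dFace : Decidable (IsFace G k)) (dFacet : Decidable (IsFacet G k))
    (dZ : Decidable (InZ G k)) (dY : Decidable (InY G k)) →
    (∀ (σ : Subset n) → IsFace G k σ ⇔ ((∣ σ ∣ ≤ n ∸ k) × ¬ InZ G k σ × ¬ InY G k σ))
    × (∀ (σ : Subset n) → ∣ σ ∣ + k + 2 ≤ n → IsFace G k σ)
    × (reducedEuler dFace ≡ sgn (n ∸ k ∸ 1) ℤ.* ((+ ((n ∸ 1) C (k ∸ 1)) ℤ.+ + count dY) - + count dZ))
    × (reducedEuler dFace ≡ sgn (n ∸ k ∸ 1) ℤ.* ((+ count dFacet - + ((n ∸ 1) C k)) ℤ.+ + count dY))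
proposition2p18 n G k 3≤k no-short cycle dFace dFacet dZ dY =
  face⇔ , small⇒face , reducedEuler≡Y-Z , reducedEuler≡facets
  where
  open FaceLattice G k 3≤k no-short (cycle-length≤n G cycle) dFace
  open FaceCounts dFacet dZ dY
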